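{- Let $S=\{s_1,\dots,s_k\}$ be a finite set of steps (with this fixed ordering), $U$ a finite set of users, and for each $u\in U$ let $A(u)\subseteq S$ be the set of steps for which $u$ is authorised; write $A^{ -1}(s)=\{u\in U : s\in A(u)\}$. Let $P=(x_1,\dots,x_k)$ be a complete pattern, let $X=\{x_i : i=1,\dots,k\}$, and for each $x\in X$ let $P^{ -1}(x)=\{s_i\in S : x_i=x\}$. Let $G=(X\cup U,E)$ be the bipartite graph in which, for $x\in X$ and $u\in U$, $(x,u)\in E$ if and only if $u\in A^{ -1}(s)$ for every $s\in P^{ -1}(x)$. Then $P$ is authorised if and only if $G$ has a matching of size $|X|$.
   Context: A plan is a function $\pi:T\to U$ with $T\subseteq S$; it is a complete plan if $T=S$. A plan $\pi:T\to U$ is authorised if $s\in A(\pi(s))$ for every $s\in T$. The pattern of a plan $\pi:T\to U$ is $P(\pi)=(x_1,\dots,x_k)$ defined recursively by: $x_i=0$ if $s_i\notin T$; $x_1=1$ if $s_1\in T$; $x_i=x_j$ if $\pi(s_i)=\pi(s_j)$ for some $j<i$ (with $s_j\in T$); and otherwise $x_i=\max\{x_1,\dots,x_{i-1}\}+1$. A pattern is any tuple of the form $P(\pi)$; it is complete if all its entries are nonzero (equivalently it is the pattern of a complete plan). A pattern $P$ is authorised if there exists an authorised plan $\pi$ with $P(\pi)=P$. -}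

module Defs where

open import Data.Nat using (ℕ; zero; suc)
import Data.Nat as ℕ
open import Data.Fin using (Fin)
import Data.Fin as Fin
open import Data.Fin.Subset using (Subset; _∈_)
open import Data.Maybe using (Maybe; just; nothing)
open import Data.Product using (_×_; _,_; ∃; ∃-syntax; proj₁; proj₂)
open import Data.List using (List; []; _∷_; length; map; deduplicate)
import Data.List.Membership.Propositional as LM
open import Data.List.Relation.Unary.Unique.Propositional using (Unique)
open import Data.Vec using (Vec; []; _∷_; lookup; tabulate; toList)
open import Relation.Binary.PropositionalEquality using (_≡_; _≢_)
open import Relation.Nullary using (yes; no)

-- Steps S = {s_1,…,s_k} are Fin k (ordering = order of Fin k).
-- Users U are Fin n.  Authorisation A : Fin n → Subset k  (A u ⊆ S).

-- A plan π : T → U with T ⊆ S, encoded as a partial function: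
-- π s ≡ nothing means s ∉ T.
Plan : ℕ → ℕ → Set
Plan k n = Fin k → Maybe (Fin n)

Complete : ∀ {k n} → Plan k n → Set
Complete π = ∀ s → ∃[ u ] π s ≡ just u

Authorised : ∀ {k n} → (Fin n → Subset k) → Plan k n → Set
Authorised A π = ∀ s u → π s ≡ just u → s ∈ A u

findLabel : ∀ {n} → Fin n → List (Fin n × ℕ) → Maybe ℕ
findLabel u [] = nothing
findLabel u ((v , x) ∷ seen) with u Fin.≟ v
... | yes _ = just x
... | no  _ = findLabel u seen

-- seen: users already assigned and their labels; mx = max of entries so far
patternGo : ∀ {n m} → Vec (Maybe (Fin n)) m → List (Fin n × ℕ) → ℕ → Vec ℕ m
patternGo [] seen mx = []
patternGo (nothing ∷ v) seen mx = 0 ∷ patternGo v seen mx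
patternGo (just u ∷ v) seen mx with findLabel u seen
... | just x  = x ∷ patternGo v seen mx
... | nothing = suc mx ∷ patternGo v ((u , suc mx) ∷ seen) (suc mx)

pattern-of : ∀ {k n} → Plan k n → Vec ℕ k
pattern-of π = patternGo (tabulate π) [] 0

IsPattern : ∀ {k} → ℕ → Vec ℕ k → Set
IsPattern {k} n P = ∃[ π ] (pattern-of {k} {n} π ≡ P)

IsCompletePattern : ∀ {k} → ℕ → Vec ℕ k → Set
IsCompletePattern n P = IsPattern n P × (∀ i → lookup P i ≢ 0)

AuthorisedPattern : ∀ {k n} → (Fin n → Subset k) → Vec ℕ k → Set
AuthorisedPattern {k} {n} A P = ∃[ π ] (Authorised A π × pattern-of π ≡ P)

_∈X_ : ∀ {k} → ℕ → Vec ℕ k → Set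
x ∈X P = x LM.∈ toList P

Xlist : ∀ {k} → Vec ℕ k → List ℕ
Xlist P = deduplicate Data.Nat._≟_ (toList P)

card-X : ∀ {k} → Vec ℕ k → ℕ
card-X P = length (Xlist P)

Edge : ∀ {k n} → (Fin n → Subset k) → Vec ℕ k → ℕ → Fin n → Set
Edge A P x u = x ∈X P × (∀ s → lookup P s ≡ x → s ∈ A u)

-- A matching in G: a list of edges (x,u), pairwise vertex-disjoint
-- (no X-vertex and no U-vertex repeated). Its size is its length.
IsMatching : ∀ {k n} → (Fin n → Subset k) → Vec ℕ k → List (ℕ × Fin n) → Set
IsMatching A P M =
  (∀ {e} → e LM.∈ M → Edge A P (proj₁ e) (proj₂ e))
  × Unique (map proj₁ M) × Unique (map proj₂ M)

HasMatchingOfSize : ∀ {k n} → (Fin n → Subset k) → Vec ℕ k → ℕ → Set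
HasMatchingOfSize {k} {n} A P m =
  ∃[ M ] (IsMatching A P M × length M ≡ m)

module Submission where

-- The heart of the proof is that the pattern of a complete plan records
-- exactly its kernel, i.e. which steps share a user:
--   * pattern-kernel: two entries of the pattern of a complete plan f agree
--     iff f assigns the two steps the same user;
--   * kernel-invariance: complete plans with the same kernel have the same
--     pattern (proved by running the pattern computation along a partial
--     bijection between the user sets).
-- A plan whose pattern has no zero entry is complete, so authorised plans
-- with pattern P are, up to kernel, authorised assignments realising the
-- kernel of P.  Such an assignment f gives a matching pairing each value x
-- with the user of a step in P⁻¹(x); conversely a matching of size |X| covers
-- all of X (pigeonhole on duplicate-free lists), and sending each step to the
-- user matched with its value is an authorised assignment realising the
-- kernel of P.

open import Defs
open import Data.Nat using (ℕ)
open import Data.Fin using (Fin)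
open import Data.Fin.Subset using (Subset)
open import Data.Vec using (Vec)
open import Function.Bundles using (_⇔_)

open import Data.Nat using (zero; suc; _≤_)
import Data.Nat as ℕ
open import Data.Nat.Properties using (≤-refl; m≤n⇒m≤1+n; 1+n≰n; <-irrefl)
import Data.Fin as Fin
open import Data.Fin.Subset using (_∈_)
open import Data.Maybe using (Maybe; just; nothing; fromMaybe)
open import Data.Product using (_×_; _,_; ∃; ∃-syntax; proj₁; proj₂)
open import Data.Sum using (_⊎_; inj₁; inj₂)
open import Data.Empty using (⊥-elim)
open import Data.List using (List; []; _∷_; length; map)
open import Data.List.Relation.Unary.All using (All; []; _∷_)
import Data.List.Relation.Unary.All as All
import Data.List.Relation.Unary.All.Properties as All
open import Data.List.Relation.Unary.Any using (here; there; any?)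
open import Data.List.Relation.Unary.AllPairs using ([]; _∷_)
open import Data.List.Relation.Binary.Pointwise using (Pointwise; []; _∷_)
import Data.List.Membership.Propositional as List
open import Data.List.Membership.Propositional.Properties using (∈-map⁻; ∈-deduplicate⁺; ∈-deduplicate⁻)
open import Data.List.Relation.Unary.Unique.Propositional using (Unique)
open import Data.List.Relation.Unary.Unique.DecPropositional.Properties ℕ._≟_ using (deduplicate-!)
open import Data.List.Properties using (length-map)
import Data.List.Fresh as Fresh
import Data.List.Fresh.Relation.Unary.Any as FreshAny
import Data.List.Fresh.Membership.Setoid as FreshMembership
import Data.List.Fresh.Membership.Setoid.Properties as FreshMembershipProperties
open import Data.Vec using (lookup; tabulate; toList; []; _∷_)
open import Data.Vec.Properties using (lookup∘tabulate; tabulate-cong)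
open import Data.Vec.Membership.Propositional using () renaming (_∈_ to _∈ᵥ_)
open import Data.Vec.Membership.Propositional.Properties using (∈-toList⁺; ∈-toList⁻; ∈-lookup)
open import Data.Vec.Relation.Unary.Any using (index)
open import Data.Vec.Relation.Unary.Any.Properties using (lookup-index)
open import Function.Base using (_∘_; id)
open import Function.Bundles using (mk⇔; Equivalence)
open import Function.Construct.Symmetry using (⇔-sym)
open import Function.Construct.Composition using (_⇔-∘_)
open import Relation.Binary.Definitions using (DecidableEquality)
open import Relation.Binary.PropositionalEquality
open import Relation.Nullary using (yes; no)

open Equivalence using (to; from)

total : ∀ {k n} → (Fin k → Fin n) → Plan k n
total f s = just (f s)

SameKernel : ∀ {m} {B C : Set} → (Fin m → B) → (Fin m → C) → Set
SameKernel f g = ∀ i j → f i ≡ f j ⇔ g i ≡ g j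

findLabel-here : ∀ {n} (u : Fin n) x seen → findLabel u ((u , x) ∷ seen) ≡ just x
findLabel-here u x seen with u Fin.≟ u
... | yes _ = refl
... | no u≢u = ⊥-elim (u≢u refl)

findLabel-there : ∀ {n} {a u : Fin n} x seen → a ≢ u →
                  findLabel a ((u , x) ∷ seen) ≡ findLabel a seen
findLabel-there {a = a} {u} x seen a≢u with a Fin.≟ u
... | yes a≡u = ⊥-elim (a≢u a≡u)
... | no _ = refl

findLabel-∷ : ∀ {n} {a u : Fin n} {x y} seen → findLabel a ((u , x) ∷ seen) ≡ just y →
              (a ≡ u × x ≡ y) ⊎ findLabel a seen ≡ just y
findLabel-∷ {a = a} {u} seen found with a Fin.≟ u
findLabel-∷ seen refl | yes a≡u = inj₁ (a≡u , refl)
... | no _ = inj₂ found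

patternGo-old : ∀ {n m} {u : Fin n} {seen mx x} (v : Vec (Maybe (Fin n)) m) →
                findLabel u seen ≡ just x →
                patternGo (just u ∷ v) seen mx ≡ x ∷ patternGo v seen mx
patternGo-old v found rewrite found = refl

patternGo-new : ∀ {n m} {u : Fin n} {seen mx} (v : Vec (Maybe (Fin n)) m) →
                findLabel u seen ≡ nothing →
                patternGo (just u ∷ v) seen mx ≡ suc mx ∷ patternGo v ((u , suc mx) ∷ seen) (suc mx)
patternGo-new v missing rewrite missing = refl

patternGo-nothing : ∀ {n m} (v : Vec (Maybe (Fin n)) m) seen mx i → lookup v i ≡ nothing →
                    lookup (patternGo v seen mx) i ≡ 0
patternGo-nothing (nothing ∷ v) seen mx Fin.zero _ = refl
patternGo-nothing (nothing ∷ v) seen mx (Fin.suc i) unassigned = patternGo-nothing v seen mx i unassigned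
patternGo-nothing (just u ∷ v) seen mx (Fin.suc i) unassigned with findLabel u seen
... | just x = patternGo-nothing v seen mx i unassigned
... | nothing = patternGo-nothing v _ _ i unassigned

complete-plan : ∀ {k n} (π : Plan k n) {P : Vec ℕ k} → pattern-of π ≡ P → (∀ s → lookup P s ≢ 0) →
                ∃[ f ] ((∀ s → π s ≡ just (f s)) × pattern-of (total f) ≡ P)
complete-plan {k} {n} π refl nonzero = f , assigned , sym (cong (λ v → patternGo v [] 0) (tabulate-cong assigned))
  where
  assignment : ∀ s → ∃[ u ] π s ≡ just u
  assignment s with π s in eq
  ... | just u = u , refl
  ... | nothing = ⊥-elim (nonzero s (patternGo-nothing (tabulate π) [] 0 s (trans (lookup∘tabulate π s) eq)))
  f : Fin k → Fin n
  f s = proj₁ (assignment s)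
  assigned : ∀ s → π s ≡ just (f s)
  assigned s = proj₂ (assignment s)

module Labelling {n : ℕ} where

  Table : Set
  Table = List (Fin n × ℕ)

  record Valid (seen : Table) (mx : ℕ) : Set where
    field
      bounded  : ∀ a x → findLabel a seen ≡ just x → x ≤ mx
      distinct : ∀ a b x → findLabel a seen ≡ just x → findLabel b seen ≡ just x → a ≡ b

  valid-[] : Valid [] 0
  valid-[] = record { bounded = λ _ _ () ; distinct = λ _ _ _ () }

  valid-∷ : ∀ {seen mx} u → Valid seen mx → Valid ((u , suc mx) ∷ seen) (suc mx)
  valid-∷ {seen} {mx} u V = record { bounded = bounded′ ; distinct = distinct′ }
    where
    open Valid V
    bounded′ : ∀ a x → findLabel a ((u , suc mx) ∷ seen) ≡ just x → x ≤ suc mx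
    bounded′ a x found with findLabel-∷ {x = suc mx} seen found
    ... | inj₁ (_ , refl) = ≤-refl
    ... | inj₂ old = m≤n⇒m≤1+n (bounded a x old)
    distinct′ : ∀ a b x → findLabel a ((u , suc mx) ∷ seen) ≡ just x →
                findLabel b ((u , suc mx) ∷ seen) ≡ just x → a ≡ b
    distinct′ a b x fa fb with findLabel-∷ {x = suc mx} seen fa | findLabel-∷ {x = suc mx} seen fb
    ... | inj₁ (a≡u , _) | inj₁ (b≡u , _) = trans a≡u (sym b≡u)
    ... | inj₁ (_ , refl) | inj₂ old = ⊥-elim (1+n≰n (bounded b _ old))
    ... | inj₂ old | inj₁ (_ , refl) = ⊥-elim (1+n≰n (bounded a _ old))
    ... | inj₂ oldA | inj₂ oldB = distinct a b x oldA oldB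

  Relevant : ∀ {m} → (Fin m → Fin n) → Table → Fin n → Set
  Relevant f seen a = (∃ λ i → f i ≡ a) ⊎ (∃ λ x → findLabel a seen ≡ just x)

  record Labels {m} (f : Fin m → Fin n) (seen : Table) (mx : ℕ) : Set where
    field
      label     : Fin n → ℕ
      entries   : ∀ i → lookup (patternGo (tabulate (total f)) seen mx) i ≡ label (f i)
      extends   : ∀ a x → findLabel a seen ≡ just x → label a ≡ x
      separates : ∀ a b → Relevant f seen a → Relevant f seen b → label a ≡ label b → a ≡ b

  labels-done : ∀ {seen mx} (f : Fin 0 → Fin n) → Valid seen mx → Labels f seen mx
  labels-done {seen} f V = record
    { label = label ; entries = λ () ; extends = extends ; separates = separates }
    where
    label : Fin n → ℕ
    label a = fromMaybe 0 (findLabel a seen)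
    extends : ∀ a x → findLabel a seen ≡ just x → label a ≡ x
    extends a x found rewrite found = refl
    separates : ∀ a b → Relevant f seen a → Relevant f seen b → label a ≡ label b → a ≡ b
    separates a b (inj₂ (x , fa)) (inj₂ (y , fb)) same rewrite fa | fb =
      Valid.distinct V a b x fa (subst (λ z → findLabel b seen ≡ just z) (sym same) fb)

  labels-old : ∀ {m} {f : Fin (suc m) → Fin n} {seen mx x} → findLabel (f Fin.zero) seen ≡ just x →
               Labels (f ∘ Fin.suc) seen mx → Labels f seen mx
  labels-old {f = f} {seen} {mx} {x} found L = record
    { label = label ; entries = entries′ ; extends = extends
    ; separates = λ a b ra rb → separates a b (relevant a ra) (relevant b rb) }
    where
    open Labels L
    entries′ : ∀ i → lookup (patternGo (tabulate (total f)) seen mx) i ≡ label (f i)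
    entries′ i = trans (cong (λ v → lookup v i) (patternGo-old (tabulate (total (f ∘ Fin.suc))) found)) (shifted i)
      where
      shifted : ∀ i → lookup (x ∷ patternGo (tabulate (total (f ∘ Fin.suc))) seen mx) i ≡ label (f i)
      shifted Fin.zero = sym (extends _ _ found)
      shifted (Fin.suc i) = entries i
    relevant : ∀ a → Relevant f seen a → Relevant (f ∘ Fin.suc) seen a
    relevant a (inj₁ (Fin.zero , refl)) = inj₂ (x , found)
    relevant a (inj₁ (Fin.suc i , fi≡a)) = inj₁ (i , fi≡a)
    relevant a (inj₂ labelled) = inj₂ labelled

  labels-new : ∀ {m} {f : Fin (suc m) → Fin n} {seen mx} → findLabel (f Fin.zero) seen ≡ nothing →
               Labels (f ∘ Fin.suc) ((f Fin.zero , suc mx) ∷ seen) (suc mx) → Labels f seen mx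
  labels-new {f = f} {seen} {mx} missing L = record
    { label = label ; entries = entries′ ; extends = extends′
    ; separates = λ a b ra rb → separates a b (relevant a ra) (relevant b rb) }
    where
    open Labels L
    u : Fin n
    u = f Fin.zero
    not-u : ∀ {a x} → findLabel a seen ≡ just x → a ≢ u
    not-u found refl with trans (sym missing) found
    ... | ()
    entries′ : ∀ i → lookup (patternGo (tabulate (total f)) seen mx) i ≡ label (f i)
    entries′ i = trans (cong (λ v → lookup v i) (patternGo-new (tabulate (total (f ∘ Fin.suc))) missing)) (shifted i)
      where
      shifted : ∀ i → lookup (suc mx ∷ patternGo (tabulate (total (f ∘ Fin.suc))) ((u , suc mx) ∷ seen) (suc mx)) i
                      ≡ label (f i)
      shifted Fin.zero = sym (extends u (suc mx) (findLabel-here u (suc mx) seen))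
      shifted (Fin.suc i) = entries i
    extends′ : ∀ a x → findLabel a seen ≡ just x → label a ≡ x
    extends′ a x found = extends a x (trans (findLabel-there (suc mx) seen (not-u found)) found)
    relevant : ∀ a → Relevant f seen a → Relevant (f ∘ Fin.suc) ((u , suc mx) ∷ seen) a
    relevant a (inj₁ (Fin.zero , refl)) = inj₂ (suc mx , findLabel-here u (suc mx) seen)
    relevant a (inj₁ (Fin.suc i , fi≡a)) = inj₁ (i , fi≡a)
    relevant a (inj₂ (x , found)) = inj₂ (x , trans (findLabel-there (suc mx) seen (not-u found)) found)

  labels : ∀ m (f : Fin m → Fin n) seen mx → Valid seen mx → Labels f seen mx
  labels zero f seen mx V = labels-done f V
  labels (suc m) f seen mx V with findLabel (f Fin.zero) seen in found
  ... | just x = labels-old found (labels m (f ∘ Fin.suc) seen mx V)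
  ... | nothing = labels-new found (labels m (f ∘ Fin.suc) _ _ (valid-∷ (f Fin.zero) V))

pattern-kernel : ∀ {k n} (f : Fin k → Fin n) → SameKernel (lookup (pattern-of (total f))) f
pattern-kernel {k} f i j = mk⇔
  (λ same → separates (f i) (f j) (inj₁ (i , refl)) (inj₁ (j , refl))
              (trans (sym (entries i)) (trans same (entries j))))
  (λ same → trans (entries i) (trans (cong label same) (sym (entries j))))
  where open Labelling.Labels (Labelling.labels k f [] 0 Labelling.valid-[])

module Renaming {n n′ : ℕ} (R : Fin n → Fin n′ → Set)
  (bijective : ∀ {a b a′ b′} → R a b → R a′ b′ → a ≡ a′ ⇔ b ≡ b′) where

  Related : Fin n × ℕ → Fin n′ × ℕ → Set
  Related (a , x) (b , y) = R a b × x ≡ y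

  findLabel-related : ∀ {t t′ a b} → Pointwise Related t t′ → R a b → findLabel a t ≡ findLabel b t′
  findLabel-related [] _ = refl
  findLabel-related {a = a} {b} (_∷_ {x = c , _} {y = d , _} (Rcd , refl) rel) Rab with a Fin.≟ c | b Fin.≟ d
  ... | yes _ | yes _ = refl
  ... | yes a≡c | no b≢d = ⊥-elim (b≢d (to (bijective Rab Rcd) a≡c))
  ... | no a≢c | yes b≡d = ⊥-elim (a≢c (from (bijective Rab Rcd) b≡d))
  ... | no _ | no _ = findLabel-related rel Rab

  patternGo-related : ∀ m (f : Fin m → Fin n) (g : Fin m → Fin n′) {t t′} mx →
                      (∀ i → R (f i) (g i)) → Pointwise Related t t′ →
                      patternGo (tabulate (total f)) t mx ≡ patternGo (tabulate (total g)) t′ mx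
  patternGo-related zero f g mx _ _ = refl
  patternGo-related (suc m) f g {t} {t′} mx Rfg rel
    with findLabel (f Fin.zero) t | findLabel (g Fin.zero) t′ | findLabel-related rel (Rfg Fin.zero)
  ... | just x | .(just x) | refl =
    cong (x ∷_) (patternGo-related m (f ∘ Fin.suc) (g ∘ Fin.suc) mx (Rfg ∘ Fin.suc) rel)
  ... | nothing | .nothing | refl =
    cong (suc mx ∷_) (patternGo-related m (f ∘ Fin.suc) (g ∘ Fin.suc) (suc mx) (Rfg ∘ Fin.suc) ((Rfg Fin.zero , refl) ∷ rel))

kernel-invariance : ∀ {k n n′} (f : Fin k → Fin n) (g : Fin k → Fin n′) → SameKernel f g →
                    pattern-of (total f) ≡ pattern-of (total g)
kernel-invariance {k} {n} {n′} f g same = patternGo-related k f g 0 (λ i → i , refl , refl) []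
  where
  R : Fin n → Fin n′ → Set
  R a b = ∃ λ i → f i ≡ a × g i ≡ b
  bijective : ∀ {a b a′ b′} → R a b → R a′ b′ → a ≡ a′ ⇔ b ≡ b′
  bijective (i , refl , refl) (j , refl , refl) = same i j
  open Renaming R bijective

module _ {A : Set} where

  Unique-map-injective : ∀ {B : Set} (h : A → B) (L : List A) {x y} → Unique (map h L) →
                         x List.∈ L → y List.∈ L → h x ≡ h y → x ≡ y
  Unique-map-injective h (_ ∷ L) _ (here refl) (here refl) _ = refl
  Unique-map-injective h (_ ∷ L) (h∉ ∷ _) (here refl) (there y∈) hx≡hy =
    ⊥-elim (All.lookup (All.map⁻ h∉) y∈ hx≡hy)
  Unique-map-injective h (_ ∷ L) (h∉ ∷ _) (there x∈) (here refl) hx≡hy =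
    ⊥-elim (All.lookup (All.map⁻ h∉) x∈ (sym hx≡hy))
  Unique-map-injective h (_ ∷ L) (_ ∷ unique) (there x∈) (there y∈) hx≡hy =
    Unique-map-injective h L unique x∈ y∈ hx≡hy

  Unique-map-reflect : ∀ {B C : Set} (g : A → B) (h : A → C) (L : List A) →
                       (∀ {a b} → a List.∈ L → b List.∈ L → h a ≡ h b → g a ≡ g b) →
                       Unique (map g L) → Unique (map h L)
  Unique-map-reflect g h [] _ _ = []
  Unique-map-reflect g h (x ∷ L) reflects (g∉ ∷ unique) =
    All.map⁺ (All.tabulate (λ b∈ hx≡hb → All.lookup (All.map⁻ g∉) b∈ (reflects (here refl) (there b∈) hx≡hb)))
    ∷ Unique-map-reflect g h L (λ a∈ b∈ → reflects (there a∈) (there b∈)) unique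

module Pigeonhole {A : Set} (_≟_ : DecidableEquality A) where

  open FreshMembership (setoid A) renaming (_∈_ to _∈#_)
  open FreshMembershipProperties (setoid A) using (strict-injection)

  ∈-fromList⁺ : ∀ {x} {xs : List A} (unique : Unique xs) → x List.∈ xs → x ∈# Fresh.fromList unique
  ∈-fromList⁺ (_ ∷ _) (here x≡y) = FreshAny.here x≡y
  ∈-fromList⁺ (_ ∷ unique) (there x∈) = FreshAny.there (∈-fromList⁺ unique x∈)

  ∈-fromList⁻ : ∀ {x} {xs : List A} (unique : Unique xs) → x ∈# Fresh.fromList unique → x List.∈ xs
  ∈-fromList⁻ (_ ∷ _) (FreshAny.here x≡y) = here x≡y
  ∈-fromList⁻ (_ ∷ unique) (FreshAny.there x∈) = there (∈-fromList⁻ unique x∈)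

  length-fromList : ∀ {xs : List A} (unique : Unique xs) → Fresh.length (Fresh.fromList unique) ≡ length xs
  length-fromList [] = refl
  length-fromList (_ ∷ unique) = cong suc (length-fromList unique)

  covers : ∀ {ys xs : List A} → Unique ys → Unique xs → (∀ {z} → z List.∈ ys → z List.∈ xs) →
           length ys ≡ length xs → ∀ {z} → z List.∈ xs → z List.∈ ys
  covers {ys} uys uxs ys⊆xs same-length {z} z∈xs with any? (z ≟_) ys
  ... | yes z∈ys = z∈ys
  ... | no z∉ys = ⊥-elim (<-irrefl same-length′ (strict-injection id
          (∈-fromList⁺ uxs ∘ ys⊆xs ∘ ∈-fromList⁻ uys)
          (z , ∈-fromList⁺ uxs z∈xs , z∉ys ∘ ∈-fromList⁻ uys)))
    where
    same-length′ : Fresh.length (Fresh.fromList uys) ≡ Fresh.length (Fresh.fromList uxs)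
    same-length′ = trans (length-fromList uys) (trans same-length (sym (length-fromList uxs)))

module Matchings {k n : ℕ} (A : Fin n → Subset k) (P : Vec ℕ k) where

  Attained : ℕ → Set
  Attained x = ∃ λ s → lookup P s ≡ x

  attained : All Attained (Xlist P)
  attained = All.tabulate (λ x∈ → attained′ (∈-toList⁻ (∈-deduplicate⁻ ℕ._≟_ (toList P) x∈)))
    where
    attained′ : ∀ {x} → x ∈ᵥ P → Attained x
    attained′ x∈P = index x∈P , sym (lookup-index x∈P)

  value∈X : ∀ s → lookup P s List.∈ Xlist P
  value∈X s = ∈-deduplicate⁺ ℕ._≟_ (∈-toList⁺ (∈-lookup s P))

  pairWith : (Fin k → Fin n) → ∀ {xs} → All Attained xs → List (ℕ × Fin n)
  pairWith f [] = []
  pairWith f {x ∷ _} ((s , _) ∷ rest) = (x , f s) ∷ pairWith f rest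

  pairWith-values : ∀ f {xs} (as : All Attained xs) → map proj₁ (pairWith f as) ≡ xs
  pairWith-values f [] = refl
  pairWith-values f {x ∷ _} (_ ∷ rest) = cong (x ∷_) (pairWith-values f rest)

  pairWith-length : ∀ f {xs} (as : All Attained xs) → length (pairWith f as) ≡ length xs
  pairWith-length f {xs} as = trans (sym (length-map proj₁ (pairWith f as))) (cong length (pairWith-values f as))

  pairWith-∈ : ∀ f {xs} (as : All Attained xs) {e} → e List.∈ pairWith f as →
               ∃ λ s → lookup P s ≡ proj₁ e × proj₂ e ≡ f s
  pairWith-∈ f ((s , Ps≡x) ∷ _) (here refl) = s , Ps≡x , refl
  pairWith-∈ f (_ ∷ rest) (there e∈) = pairWith-∈ f rest e∈

  matching-from-plan : (f : Fin k → Fin n) → (∀ s → s ∈ A (f s)) → SameKernel (lookup P) f →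
                       HasMatchingOfSize A P (card-X P)
  matching-from-plan f authorised realises =
    M , (edges , values-unique , users-unique) , pairWith-length f attained
    where
    M : List (ℕ × Fin n)
    M = pairWith f attained
    edges : ∀ {e} → e List.∈ M → Edge A P (proj₁ e) (proj₂ e)
    edges e∈ with pairWith-∈ f attained e∈
    ... | s , refl , refl = ∈-toList⁺ (∈-lookup s P) ,
      λ t Pt≡Ps → subst (λ u → t ∈ A u) (to (realises t s) Pt≡Ps) (authorised t)
    values-unique : Unique (map proj₁ M)
    values-unique = subst Unique (sym (pairWith-values f attained)) (deduplicate-! (toList P))
    same-value : ∀ {a b} → a List.∈ M → b List.∈ M → proj₂ a ≡ proj₂ b → proj₁ a ≡ proj₁ b
    same-value a∈ b∈ same-user with pairWith-∈ f attained a∈ | pairWith-∈ f attained b∈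
    ... | s , refl , refl | t , refl , refl = from (realises s t) same-user
    users-unique : Unique (map proj₂ M)
    users-unique = Unique-map-reflect proj₁ proj₂ M same-value values-unique

  plan-from-matching : HasMatchingOfSize A P (card-X P) →
                       ∃[ g ] ((∀ s → s ∈ A (g s)) × SameKernel (lookup P) g)
  plan-from-matching (M , (edges , values-unique , users-unique) , size) = g , authorised , realises
    where
    open Pigeonhole ℕ._≟_ using (covers)
    matched : ∀ s → ∃ λ e → e List.∈ M × lookup P s ≡ proj₁ e
    matched s = ∈-map⁻ proj₁ (covers values-unique (deduplicate-! (toList P))
      matched-values∈X (trans (length-map proj₁ M) size) (value∈X s))
      where
      matched-values∈X : ∀ {x} → x List.∈ map proj₁ M → x List.∈ Xlist P
      matched-values∈X x∈ with ∈-map⁻ proj₁ x∈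
      ... | _ , e∈ , refl = ∈-deduplicate⁺ ℕ._≟_ (proj₁ (edges e∈))
    g : Fin k → Fin n
    g s = proj₂ (proj₁ (matched s))
    authorised : ∀ s → s ∈ A (g s)
    authorised s = let (_ , e∈ , Ps≡x) = matched s in proj₂ (edges e∈) s Ps≡x
    realises : SameKernel (lookup P) g
    realises s t with matched s | matched t
    ... | e , e∈ , Ps≡x | e′ , e′∈ , Pt≡x′ = mk⇔
      (λ Ps≡Pt → cong proj₂ (Unique-map-injective proj₁ M values-unique e∈ e′∈ (trans (sym Ps≡x) (trans Ps≡Pt Pt≡x′))))
      (λ gs≡gt → trans Ps≡x (trans (cong proj₁ (Unique-map-injective proj₂ M users-unique e∈ e′∈ gs≡gt)) (sym Pt≡x′)))

theorem1 : (k n : ℕ) (A : Fin n → Subset k) (P : Vec ℕ k) →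
    IsCompletePattern n P →
    (AuthorisedPattern A P ⇔ HasMatchingOfSize A P (card-X P))
theorem1 k n A P ((π , pattern-π) , nonzero) = mk⇔ forward backward
  where
  open Matchings A P

  realises : ∀ {f : Fin k → Fin n} → pattern-of (total f) ≡ P → SameKernel (lookup P) f
  realises {f} refl = pattern-kernel f

  forward : AuthorisedPattern A P → HasMatchingOfSize A P (card-X P)
  forward (π′ , authorised , pattern-π′) =
    let (f , assigned , pattern-f) = complete-plan π′ pattern-π′ nonzero
    in matching-from-plan f (λ s → authorised s (f s) (assigned s)) (realises pattern-f)

  backward : HasMatchingOfSize A P (card-X P) → AuthorisedPattern A P
  backward matching with complete-plan π pattern-π nonzero | plan-from-matching matching
  ... | f , _ , pattern-f | g , authorised , realises-g =
    total g , (λ { s u refl → authorised s }) , trans (sym (kernel-invariance f g same-kernel)) pattern-f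
    where
    same-kernel : SameKernel f g
    same-kernel i j = realises-g i j ⇔-∘ ⇔-sym (realises pattern-f i j)
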